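{- Let $G=(V,E)$ be a connected graph with $V=[n]$, let $k$ be an integer with $1\le k\le n$, and let ${\rm W}\subseteq V$ be nonempty. For every $w\in{\rm W}$, the subgraph of $G$ induced by $\mathrm{cell}(w)\setminus R$ is connected. Furthermore, for every $v\in\mathrm{cell}(w)\setminus R$, the set $\mathrm{cell}(w)\setminus R$ contains all vertices lying on shortest paths (in $G$) between $v$ and $w$.
   Context: $d(u,v)$ denotes the shortest-path distance in $G$, and $\Gamma_\ell(v)=\{u\in V: d(u,v)\le \ell\}$. Vertices are identified with their identifiers in $[n]$. For $v\in V$, $\mathrm{cent}(v)$ is the vertex with minimum identifier in $\{y\in{\rm W}: d(y,v)=\min_{w'\in{\rm W}} d(w',v)\}$, and for $w\in{\rm W}$, $\mathrm{cell}(w)=\{v\in V:\mathrm{cent}(v)=w\}$. For $v\in V$, $\ell_k(v)$ is the minimum integer $\ell\ge0$ such that $|\Gamma_\ell(v)|\ge k$, and $B_k(v)=\Gamma_{\ell_k(v)}(v)$ (the vertex set of the BFS tree from $v$ of depth $\ell_k(v)$). The set of remote vertices is $R=\{v\in V: B_k(v)\cap{\rm W}=\emptyset\}$. -}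

module Defs where

open import Data.Nat using (ℕ; zero; suc; _≤_; _<_)
open import Data.Fin using (Fin; toℕ)
open import Data.Fin.Subset using (Subset; _∈_)
open import Data.Product using (Σ; ∃; _×_; _,_)
open import Data.Empty using (⊥)
open import Relation.Nullary using (¬_)
open import Relation.Binary.PropositionalEquality using (_≡_)
open import Function.Definitions using (Injective)

record Graph (n : ℕ) : Set₁ where
  field
    Adj   : Fin n → Fin n → Set
    sym   : ∀ {u v} → Adj u v → Adj v u
    irrefl : ∀ {u} → ¬ Adj u u
open Graph public

module _ {n : ℕ} (G : Graph n) where

  data Walk : Fin n → Fin n → ℕ → Set where
    nil  : ∀ {u} → Walk u u zero
    cons : ∀ {u v w m} → Adj G u v → Walk v w m → Walk u w (suc m)

  data OnWalk (x : Fin n) : ∀ {u v m} → Walk u v m → Set where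
    here  : ∀ {v m} {p : Walk x v m} → OnWalk x p
    there : ∀ {u u' v m} {a : Adj G u u'} {p : Walk u' v m} →
            OnWalk x p → OnWalk x (cons a p)

  data AllOn (P : Fin n → Set) : ∀ {u v m} → Walk u v m → Set where
    nil  : ∀ {u} → P u → AllOn P (nil {u})
    cons : ∀ {u u' v m} {a : Adj G u u'} {p : Walk u' v m} →
           P u → AllOn P p → AllOn P (cons a p)

  Connected : Set
  Connected = ∀ u v → ∃ λ m → Walk u v m

  Dist : Fin n → Fin n → ℕ → Set
  Dist u v m = Walk u v m × (∀ m' → Walk u v m' → m ≤ m')

  OnShortestPath : Fin n → Fin n → Fin n → Set
  OnShortestPath u v x =
    ∃ λ m → Dist u v m × Σ (Walk u v m) (λ p → OnWalk x p)

  InducedConnected : (Fin n → Set) → Set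
  InducedConnected S = ∀ u v → S u → S v →
    ∃ λ m → Σ (Walk u v m) (λ p → AllOn S p)

  Γ : ℕ → Fin n → Fin n → Set
  Γ ℓ v u = ∃ λ m → Dist u v m × m ≤ ℓ

  AtLeast : ℕ → (Fin n → Set) → Set
  AtLeast k S = Σ (Fin k → Fin n) λ f → Injective _≡_ _≡_ f × (∀ i → S (f i))

  IsEllK : ℕ → Fin n → ℕ → Set
  IsEllK k v ℓ = AtLeast k (Γ ℓ v) × (∀ ℓ' → ℓ' < ℓ → ¬ AtLeast k (Γ ℓ' v))

  InBall : ℕ → Fin n → Fin n → Set
  InBall k v u = ∀ ℓ → IsEllK k v ℓ → Γ ℓ v u

  module _ (W : Subset n) where

    IsCent : Fin n → Fin n → Set
    IsCent v c = c ∈ W × (∃ λ dc → Dist c v dc ×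
      (∀ y → y ∈ W → ∀ dy → Dist y v dy → dc ≤ dy) ×
      (∀ y → y ∈ W → ∀ dy → Dist y v dy → dy ≡ dc → toℕ c ≤ toℕ y))

    InCell : Fin n → Fin n → Set
    InCell w v = IsCent v w

    -- v ∈ R  (B_k(v) ∩ W = ∅)
    Remote : ℕ → Fin n → Set
    Remote k v = ∀ ℓ → IsEllK k v ℓ → ∀ u → u ∈ W → ¬ Γ ℓ v u

    CellMinusR : ℕ → Fin n → Fin n → Set
    CellMinusR k w v = InCell w v × ¬ Remote k v

-- If x lies on a geodesic from w to v ∈ cell(w), with d(w,x) = b and d(x,v) = a,
-- then every y ∈ W has d(y,v) ≤ d(y,x) + a, so w is still the nearest (and
-- tie-winning) centre of x. Moving the centre of a ball by a changes ℓ_k by at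
-- most a; since some u ∈ W lies within ℓ_k(v) of v and d(w,v) ≤ d(u,v), this
-- gives d(w,x) = d(w,v) − a ≤ ℓ_k(x), so x is not remote. Connectivity follows
-- because every vertex of cell(w) ∖ R is joined to w by a geodesic.
-- Adjacency is an arbitrary relation, so distances and ℓ_k exist only
-- classically; all minimisations happen in the double-negation monad, which is
-- harmless since every goal they serve is a negation or a decidable inequality.
module Submission where

open import Defs
open import Data.Nat using (ℕ; suc; _+_; _≤_; _<_; _≤?_)
open import Data.Nat.Properties
open import Data.Nat.Induction using (<-rec)
open import Data.Fin using (Fin; toℕ)
open import Data.Fin.Properties using (sequence)
open import Data.Fin.Subset using (Subset; _∈_; Nonempty)
open import Data.Product using (Σ; ∃; _×_; _,_; proj₁)
open import Effect.Monad using (RawMonad)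
open import Function using (_∘_; _$_)
open import Level using (0ℓ)
open import Relation.Nullary.Decidable using (decidable-stable)
open import Relation.Nullary.Negation using (¬¬-Monad)
open import Relation.Nullary.Negation.Core using (DoubleNegation)
open import Relation.Binary.PropositionalEquality using (_≡_; refl; subst)

open RawMonad (¬¬-Monad {a = 0ℓ})

≤-stable : ∀ {m n} → DoubleNegation (m ≤ n) → m ≤ n
≤-stable = decidable-stable (_ ≤? _)

Least : (ℕ → Set) → Set
Least P = Σ ℕ λ m → P m × (∀ m' → P m' → m ≤ m')

¬¬-least : ∀ {P : ℕ → Set} {L} → P L → DoubleNegation (Least P)
¬¬-least {P} {L} = <-rec (λ L → P L → DoubleNegation (Least P)) step L
  where
  step : ∀ L → (∀ {m} → m < L → P m → DoubleNegation (Least P)) →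
         P L → DoubleNegation (Least P)
  step L below pL ¬least =
    ¬least (L , pL , λ m pm → ≤-stable (λ L≰m → below (≰⇒> L≰m) pm ¬least))

module _ {n : ℕ} (G : Graph n) where

  infixr 5 _++_
  infixl 5 _∷ʳ_

  _++_ : ∀ {u v w a b} → Walk G u v a → Walk G v w b → Walk G u w (a + b)
  nil      ++ q = q
  cons e p ++ q = cons e (p ++ q)

  _∷ʳ_ : ∀ {u v w m} → Walk G u v m → Adj G v w → Walk G u w (suc m)
  nil      ∷ʳ e' = cons e' nil
  cons e p ∷ʳ e' = cons e (p ∷ʳ e')

  reverse : ∀ {u v m} → Walk G u v m → Walk G v u m
  reverse nil        = nil
  reverse (cons e p) = reverse p ∷ʳ sym G e

  OnWalk-split : ∀ {x u w m} (p : Walk G u w m) → OnWalk G x p →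
    Σ ℕ λ a → Σ ℕ λ b → Walk G u x a × Walk G x w b × a + b ≡ m
  OnWalk-split p here = 0 , _ , nil , p , refl
  OnWalk-split (cons e p) (there x∈p) with OnWalk-split p x∈p
  ... | a , b , u→x , x→w , refl = suc a , b , cons e u→x , x→w , refl

  module _ {S : Fin n → Set} where

    AllOn-tabulate : ∀ {u v m} (p : Walk G u v m) → (∀ x → OnWalk G x p → S x) → AllOn G S p
    AllOn-tabulate nil        f = nil (f _ here)
    AllOn-tabulate (cons e p) f = cons (f _ here) (AllOn-tabulate p (λ x → f x ∘ there))

    AllOn-++ : ∀ {u v w a b} {p : Walk G u v a} {q : Walk G v w b} →
      AllOn G S p → AllOn G S q → AllOn G S (p ++ q)
    AllOn-++ (nil _)       q∈S = q∈S
    AllOn-++ (cons su p∈S) q∈S = cons su (AllOn-++ p∈S q∈S)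

    AllOn-∷ʳ : ∀ {u v w m} {p : Walk G u v m} {e : Adj G v w} →
      AllOn G S p → S w → AllOn G S (p ∷ʳ e)
    AllOn-∷ʳ (nil su)      sw = cons su (nil sw)
    AllOn-∷ʳ (cons su p∈S) sw = cons su (AllOn-∷ʳ p∈S sw)

    AllOn-reverse : ∀ {u v m} {p : Walk G u v m} → AllOn G S p → AllOn G S (reverse p)
    AllOn-reverse (nil su)      = nil su
    AllOn-reverse (cons su p∈S) = AllOn-∷ʳ (AllOn-reverse p∈S) su

  Dist-sym : ∀ {u v m} → Dist G u v m → Dist G v u m
  Dist-sym (p , shortest) = reverse p , λ m' q → shortest m' (reverse q)

  Dist-unique : ∀ {u v a b} → Dist G u v a → Dist G u v b → a ≡ b
  Dist-unique (p , p-shortest) (q , q-shortest) = ≤-antisym (p-shortest _ q) (q-shortest _ p)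

  ¬¬-Dist≤ : ∀ {u v L} → Walk G u v L → DoubleNegation (∃ λ m → Dist G u v m × m ≤ L)
  ¬¬-Dist≤ p = do
    (m , q , shortest) ← ¬¬-least p
    pure (m , (q , shortest) , shortest _ p)

  Dist-suffix : ∀ {u x w a b m} → Dist G u w m →
    Walk G u x a → Walk G x w b → a + b ≡ m → Dist G x w b
  Dist-suffix {a = a} {b} (_ , shortest) p q refl =
    q , λ b' q' → +-cancelˡ-≤ a b b' (shortest _ (p ++ q'))

  Γ-++ : ∀ {x y u a ℓ} → Γ G ℓ x u → Walk G x y a → DoubleNegation (Γ G (ℓ + a) y u)
  Γ-++ {a = a} (m , (q , _) , m≤ℓ) p = do
    (m' , d , m'≤m+a) ← ¬¬-Dist≤ (q ++ p)
    pure (m' , d , ≤-trans m'≤m+a (+-monoˡ-≤ a m≤ℓ))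

  AtLeast-Γ-++ : ∀ {k x y a ℓ} → AtLeast G k (Γ G ℓ x) → Walk G x y a →
    DoubleNegation (AtLeast G k (Γ G (ℓ + a) y))
  AtLeast-Γ-++ (f , f-injective , f∈Γ) p = do
    f∈Γ' ← sequence rawApplicative (λ i → Γ-++ (f∈Γ i) p)
    pure (f , (λ {i j} → f-injective) , f∈Γ')

  IsEllK-lipschitz : ∀ {k v x a ℓ} → IsEllK G k v ℓ → Walk G x v a →
    DoubleNegation (∃ λ ℓ' → IsEllK G k x ℓ' × ℓ ≤ ℓ' + a)
  IsEllK-lipschitz (atLeastᵥ , belowᵥ) x→v = do
    atLeastₓ ← AtLeast-Γ-++ atLeastᵥ (reverse x→v)
    (ℓ' , atLeastₓ' , leastₓ) ← ¬¬-least atLeastₓ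
    atLeastᵥ' ← AtLeast-Γ-++ atLeastₓ' x→v
    pure ( ℓ'
         , (atLeastₓ' , λ ℓ'' ℓ''<ℓ' → <⇒≱ ℓ''<ℓ' ∘ leastₓ ℓ'')
         , ≮⇒≥ (λ ℓ'+a<ℓ → belowᵥ _ ℓ'+a<ℓ atLeastᵥ') )

  module _ (W : Subset n) (w : Fin n) where

    InCell-geodesic : ∀ {v x a b} → InCell G W w v → Dist G w v (b + a) →
      Dist G w x b → Walk G x v a → InCell G W w x
    InCell-geodesic {v} {x} {a} {b} (w∈W , dc , w⇝v , nearest , tiebreak) w⇝v' w⇝x x→v =
      w∈W , b , w⇝x , nearestₓ , tiebreakₓ
      where
      open ≤-Reasoning

      b+a≡dc : b + a ≡ dc
      b+a≡dc = Dist-unique w⇝v' w⇝v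

      via-x : ∀ {y dy} → Dist G y x dy → DoubleNegation (∃ λ d → Dist G y v d × d ≤ dy + a)
      via-x (y→x , _) = ¬¬-Dist≤ (y→x ++ x→v)

      nearestₓ : ∀ y → y ∈ W → ∀ dy → Dist G y x dy → b ≤ dy
      nearestₓ y y∈W dy y⇝x = ≤-stable $ do
        (d , y⇝v , d≤dy+a) ← via-x y⇝x
        pure (+-cancelʳ-≤ a b dy (begin
          b + a   ≡⟨ b+a≡dc ⟩
          dc      ≤⟨ nearest y y∈W d y⇝v ⟩
          d       ≤⟨ d≤dy+a ⟩
          dy + a  ∎))

      tiebreakₓ : ∀ y → y ∈ W → ∀ dy → Dist G y x dy → dy ≡ b → toℕ w ≤ toℕ y
      tiebreakₓ y y∈W dy y⇝x refl = ≤-stable $ do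
        (d , y⇝v , d≤dy+a) ← via-x y⇝x
        pure (tiebreak y y∈W d y⇝v
          (≤-antisym (subst (d ≤_) b+a≡dc d≤dy+a) (nearest y y∈W d y⇝v)))

    module _ (k : ℕ) where

      Remote-geodesic : ∀ {v x a b} → InCell G W w v → Dist G w v (b + a) →
        Dist G w x b → Walk G x v a → Remote G W k x → Remote G W k v
      Remote-geodesic {a = a} {b} (w∈W , dc , w⇝v , nearest , _) w⇝v' w⇝x x→v x-remote
                      ℓ ℓ≡ℓk u u∈W (du , u⇝v , du≤ℓ) =
        IsEllK-lipschitz ℓ≡ℓk x→v λ (ℓ' , ℓ'≡ℓk , ℓ≤ℓ'+a) →
          x-remote ℓ' ℓ'≡ℓk w w∈W (b , w⇝x , +-cancelʳ-≤ a b ℓ' (begin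
            b + a   ≡⟨ Dist-unique w⇝v' w⇝v ⟩
            dc      ≤⟨ nearest u u∈W du u⇝v ⟩
            du      ≤⟨ du≤ℓ ⟩
            ℓ       ≤⟨ ℓ≤ℓ'+a ⟩
            ℓ' + a  ∎))
        where open ≤-Reasoning

      CellMinusR-convex : ∀ v → CellMinusR G W k w v →
        ∀ x → OnShortestPath G v w x → CellMinusR G W k w x
      CellMinusR-convex v (v∈cell , v∉R) x (m , v⇝w , p , x∈p) with OnWalk-split p x∈p
      ... | a , b , v→x , x→w , refl =
        InCell-geodesic v∈cell w⇝v w⇝x x→v ,
        v∉R ∘ Remote-geodesic v∈cell w⇝v w⇝x x→v
        where
        w⇝v : Dist G w v (b + a)
        w⇝v = subst (Dist G w v) (+-comm a b) (Dist-sym v⇝w)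
        w⇝x : Dist G w x b
        w⇝x = Dist-sym (Dist-suffix v⇝w v→x x→w refl)
        x→v : Walk G x v a
        x→v = reverse v→x

      toCentre : ∀ v → CellMinusR G W k w v →
        Σ ℕ λ m → Σ (Walk G v w m) (AllOn G (CellMinusR G W k w))
      toCentre v v∈S@((_ , d , w⇝v , _) , _) =
        d , reverse (proj₁ w⇝v) , AllOn-tabulate _ λ x x∈p →
          CellMinusR-convex v v∈S x (d , Dist-sym w⇝v , _ , x∈p)

      CellMinusR-connected : InducedConnected G (CellMinusR G W k w)
      CellMinusR-connected u v u∈S v∈S with toCentre u u∈S | toCentre v v∈S
      ... | a , u→w , u→w∈S | b , v→w , v→w∈S =
        a + b , u→w ++ reverse v→w , AllOn-++ u→w∈S (AllOn-reverse v→w∈S)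

lemma3p2 : (n : ℕ) (G : Graph n) → Connected G →
    (k : ℕ) → 1 ≤ k → k ≤ n →
    (W : Subset n) → Nonempty W →
    (w : Fin n) → w ∈ W →
      InducedConnected G (CellMinusR G W k w)
      × (∀ v → CellMinusR G W k w v → ∀ x → OnShortestPath G v w x → CellMinusR G W k w x)
lemma3p2 n G _ k _ _ W _ w _ = CellMinusR-connected G W w k , CellMinusR-convex G W w k
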